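{- For any graph $G$, $\frac{3}{2}\, i_{\{R2\}}(G)\le i_{dR}(G)\le 2\, i_{\{R2\}}(G)$, and both bounds are sharp.
   Context: An independent double Roman dominating function (IDRDF) on a graph $G=(V,E)$ is a function $f:V\to\{0,1,2,3\}$ such that: every vertex $v$ with $f(v)=0$ has at least two neighbors $w$ with $f(w)=2$ or at least one neighbor $w$ with $f(w)=3$; every vertex $v$ with $f(v)=1$ has a neighbor $w$ with $f(w)\ge 2$; and $\{v: f(v)>0\}$ is independent. $i_{dR}(G)$ is the minimum weight $\sum_v f(v)$ of an IDRDF on $G$. A Roman $\{2\}$-dominating function is a function $g:V\to\{0,1,2\}$ such that every $v$ with $g(v)=0$ satisfies $\sum_{u\in N(v)}g(u)\ge 2$; it is independent if $\{v:g(v)>0\}$ is an independent set. $i_{\{R2\}}(G)$ is the minimum weight $\sum_v g(v)$ of an independent Roman $\{2\}$-dominating function on $G$. -}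

module Defs where

open import Data.Nat using (ℕ; zero; suc; _+_; _*_; _≤_)
open import Data.Fin using (Fin; zero; suc)
open import Data.Bool using (Bool; true; false; if_then_else_)
open import Data.Product using (Σ; ∃; _×_; _,_)
open import Data.Sum using (_⊎_)
open import Relation.Binary.PropositionalEquality using (_≡_; _≢_)

record Graph (n : ℕ) : Set where
  field
    adj   : Fin n → Fin n → Bool
    sym   : ∀ u v → adj u v ≡ adj v u
    irrefl : ∀ v → adj v v ≡ false
open Graph public

sumFin : (n : ℕ) → (Fin n → ℕ) → ℕ
sumFin zero    f = 0
sumFin (suc n) f = f zero + sumFin n (λ i → f (suc i))

weight : {n : ℕ} → (Fin n → ℕ) → ℕ
weight {n} f = sumFin n f

nbrSum : {n : ℕ} → Graph n → (Fin n → ℕ) → Fin n → ℕ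
nbrSum {n} G g v = sumFin n (λ u → if adj G v u then g u else 0)

Independent : {n : ℕ} → Graph n → (Fin n → ℕ) → Set
Independent G f = ∀ u v → adj G u v ≡ true → f u ≡ 0 ⊎ f v ≡ 0

record IsIDRDF {n : ℕ} (G : Graph n) (f : Fin n → ℕ) : Set where
  field
    range : ∀ v → f v ≤ 3
    zeroCond : ∀ v → f v ≡ 0 →
      (∃ λ w → adj G v w ≡ true × f w ≡ 3) ⊎
      (Σ (Fin n) λ w → Σ (Fin n) λ w' → w ≢ w' × adj G v w ≡ true × adj G v w' ≡ true
                                          × f w ≡ 2 × f w' ≡ 2)
    oneCond : ∀ v → f v ≡ 1 → ∃ λ w → adj G v w ≡ true × 2 ≤ f w
    indep : Independent G f

record IsIR2DF {n : ℕ} (G : Graph n) (g : Fin n → ℕ) : Set where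
  field
    range : ∀ v → g v ≤ 2
    zeroCond : ∀ v → g v ≡ 0 → 2 ≤ nbrSum G g v
    indep : Independent G g

IsMinWeight : {n : ℕ} → ((Fin n → ℕ) → Set) → ℕ → Set
IsMinWeight P m = (∃ λ f → P f × weight f ≡ m) × (∀ f → P f → m ≤ weight f)

IsIdR : {n : ℕ} → Graph n → ℕ → Set
IsIdR G = IsMinWeight (IsIDRDF G)

IsIR2 : {n : ℕ} → Graph n → ℕ → Set
IsIR2 G = IsMinWeight (IsIR2DF G)

module Submission where

-- Both inequalities come from weight-controlled translations
-- between the two kinds of functions.
--   * halve (3 ↦ 2, 2 ↦ 1, 0/1 ↦ 0) turns an IDRDF f into an independent
--     Roman {2}-dominating function with 3 · halve x ≤ 2 · x pointwise;
--     hence 3 · i_{R2}(G) ≤ 2 · w(f) for every IDRDF f, in particular for a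
--     minimum one:  3 · i_{R2} ≤ 2 · i_dR.
--   * promote (2 ↦ 3, 1 ↦ 2, 0 ↦ 0) turns an independent Roman {2}-dominating
--     function g into an IDRDF with promote x ≤ 2 · x, so i_dR ≤ 2 · i_{R2}.  On both graphs only i_{R2} is computed by hand;
-- the minimality of i_dR follows from the lower bound already proved.

open import Defs hiding (sym)
open import Data.Nat using (ℕ; zero; suc; _+_; _*_; _≤_; z≤n; s≤s)
open import Data.Nat.Properties
  using (≤-refl; ≤-trans; +-mono-≤; +-monoʳ-≤; m≤m+n; m≤n+m; +-comm;
         *-zeroʳ; *-distribˡ-+; *-monoʳ-≤; *-cancelˡ-≤; *-identityˡ; module ≤-Reasoning)
open import Data.Fin using (Fin; zero; suc)
open import Data.Fin.Properties using (suc-injective)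
open import Data.Bool using (Bool; true; false; if_then_else_)
open import Data.Product using (Σ; ∃; _×_; _,_)
open import Data.Sum using (_⊎_; inj₁; inj₂)
open import Data.Empty using (⊥-elim)
open import Function using (_∘_)
open import Relation.Binary.PropositionalEquality
  using (_≡_; _≢_; refl; sym; trans; cong; subst)

sum-mono : ∀ n {p q : Fin n → ℕ} → (∀ i → p i ≤ q i) → sumFin n p ≤ sumFin n q
sum-mono zero    le = z≤n
sum-mono (suc n) le = +-mono-≤ (le zero) (sum-mono n (le ∘ suc))

sum-scale : ∀ n c (p : Fin n → ℕ) → sumFin n (λ i → c * p i) ≡ c * sumFin n p
sum-scale zero    c p = sym (*-zeroʳ c)
sum-scale (suc n) c p =
  trans (cong (c * p zero +_) (sum-scale n c (p ∘ suc)))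
        (sym (*-distribˡ-+ c (p zero) (sumFin n (p ∘ suc))))

sum-single : ∀ n (p : Fin n → ℕ) w → p w ≤ sumFin n p
sum-single (suc n) p zero    = m≤m+n (p zero) _
sum-single (suc n) p (suc w) = ≤-trans (sum-single n (p ∘ suc) w) (m≤n+m _ (p zero))

sum-pair : ∀ n (p : Fin n → ℕ) w w' → w ≢ w' → p w + p w' ≤ sumFin n p
sum-pair (suc n) p zero    zero     w≢w' = ⊥-elim (w≢w' refl)
sum-pair (suc n) p zero    (suc w') w≢w' = +-monoʳ-≤ (p zero) (sum-single n (p ∘ suc) w')
sum-pair (suc n) p (suc w) zero     w≢w' =
  subst (_≤ sumFin (suc n) p) (+-comm (p zero) (p (suc w)))
        (+-monoʳ-≤ (p zero) (sum-single n (p ∘ suc) w))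
sum-pair (suc n) p (suc w) (suc w') w≢w' =
  ≤-trans (sum-pair n (p ∘ suc) w w' (w≢w' ∘ cong suc)) (m≤n+m _ (p zero))

sum-positive : ∀ n (p : Fin n → ℕ) → (∀ i → p i ≤ 2) → 1 ≤ sumFin n p →
               ∃ λ w → p w ≡ 1 ⊎ p w ≡ 2
sum-positive (suc n) p bound pos with p zero in p0 | bound zero
... | .0 | z≤n           = let (w , pw) = sum-positive n (p ∘ suc) (bound ∘ suc) pos
                           in suc w , pw
... | .1 | s≤s z≤n       = zero , inj₁ p0
... | .2 | s≤s (s≤s z≤n) = zero , inj₂ p0

-- A sum ≥ 2 of terms bounded by 2 contains a 2, or two 1s at distinct positions.
-- This is how "weight ≥ 2 on N(v)" is turned into the IDRDF condition.
sum-two : ∀ n (p : Fin n → ℕ) → (∀ i → p i ≤ 2) → 2 ≤ sumFin n p →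
          (∃ λ w → p w ≡ 2) ⊎ (Σ (Fin n) λ w → Σ (Fin n) λ w' → w ≢ w' × p w ≡ 1 × p w' ≡ 1)
sum-two (suc n) p bound two with p zero in p0 | bound zero
... | .0 | z≤n with sum-two n (p ∘ suc) (bound ∘ suc) two
...   | inj₁ (w , pw)                = inj₁ (suc w , pw)
...   | inj₂ (w , w' , w≢w' , pw , pw') =
          inj₂ (suc w , suc w' , w≢w' ∘ suc-injective , pw , pw')
sum-two (suc n) p bound (s≤s rest) | .1 | s≤s z≤n
  with sum-positive n (p ∘ suc) (bound ∘ suc) rest
... | w , inj₁ pw = inj₂ (zero , suc w , (λ ()) , p0 , pw)
... | w , inj₂ pw = inj₁ (suc w , pw)
sum-two (suc n) p bound two | .2 | s≤s (s≤s z≤n) = inj₁ (zero , p0)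

module _ {n : ℕ} (G : Graph n) (g : Fin n → ℕ) where

  nbrTerm : Fin n → Fin n → ℕ
  nbrTerm v u = if adj G v u then g u else 0

  nbrTerm-adj : ∀ {v u} → adj G v u ≡ true → nbrTerm v u ≡ g u
  nbrTerm-adj {v} {u} a rewrite a = refl

  nbrTerm-pos : ∀ {v u m} → nbrTerm v u ≡ suc m → adj G v u ≡ true × g u ≡ suc m
  nbrTerm-pos {v} {u} t with adj G v u
  ... | true = refl , t

  nbrTerm-≤2 : (∀ u → g u ≤ 2) → ∀ v u → nbrTerm v u ≤ 2
  nbrTerm-≤2 bound v u with adj G v u
  ... | true  = bound u
  ... | false = z≤n

  TwoUnder : Fin n → Set
  TwoUnder v = (∃ λ w → adj G v w ≡ true × g w ≡ 2)
             ⊎ (Σ (Fin n) λ w → Σ (Fin n) λ w' → w ≢ w' × adj G v w ≡ true × adj G v w' ≡ true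
                                                 × g w ≡ 1 × g w' ≡ 1)

  nbrSum-from-two : ∀ v → TwoUnder v → 2 ≤ nbrSum G g v
  nbrSum-from-two v (inj₁ (w , a , gw)) =
    subst (_≤ nbrSum G g v) (trans (nbrTerm-adj a) gw) (sum-single n (nbrTerm v) w)
  nbrSum-from-two v (inj₂ (w , w' , w≢w' , a , a' , gw , gw')) =
    subst (_≤ nbrSum G g v) (cong₂-+ (trans (nbrTerm-adj a) gw) (trans (nbrTerm-adj a') gw'))
          (sum-pair n (nbrTerm v) w w' w≢w')
    where
    cong₂-+ : ∀ {x y} → x ≡ 1 → y ≡ 1 → x + y ≡ 2
    cong₂-+ refl refl = refl

  nbrSum-to-two : (∀ u → g u ≤ 2) → ∀ v → 2 ≤ nbrSum G g v → TwoUnder v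
  nbrSum-to-two bound v two with sum-two n (nbrTerm v) (nbrTerm-≤2 bound v) two
  ... | inj₁ (w , t) = let (a , gw) = nbrTerm-pos t in inj₁ (w , a , gw)
  ... | inj₂ (w , w' , w≢w' , t , t') =
        let (a , gw) = nbrTerm-pos t ; (a' , gw') = nbrTerm-pos t'
        in inj₂ (w , w' , w≢w' , a , a' , gw , gw')

independent-map : ∀ {n} (G : Graph n) (φ : ℕ → ℕ) {f : Fin n → ℕ} →
                  φ 0 ≡ 0 → Independent G f → Independent G (φ ∘ f)
independent-map G φ φ0 ind u v a with ind u v a
... | inj₁ fu = inj₁ (trans (cong φ fu) φ0)
... | inj₂ fv = inj₂ (trans (cong φ fv) φ0)

min-weight-compare : ∀ {n} {P Q : (Fin n → ℕ) → Set} {b} (φ : ℕ → ℕ) (c d : ℕ) →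
                     IsMinWeight Q b → (∀ f → P f → Q (φ ∘ f)) →
                     (∀ x → c * φ x ≤ d * x) →
                     ∀ f → P f → c * b ≤ d * weight f
min-weight-compare {n} {b = b} φ c d (_ , minimal) translate scaled f Pf = begin
  c * b                         ≤⟨ *-monoʳ-≤ c (minimal (φ ∘ f) (translate f Pf)) ⟩
  c * weight (φ ∘ f)            ≡⟨ sym (sum-scale n c (φ ∘ f)) ⟩
  sumFin n (λ v → c * φ (f v))  ≤⟨ sum-mono n (scaled ∘ f) ⟩
  sumFin n (λ v → d * f v)      ≡⟨ sum-scale n d f ⟩
  d * weight f                  ∎
  where open ≤-Reasoning

halve : ℕ → ℕ
halve 3 = 2
halve 2 = 1
halve _ = 0

halve-≤2 : ∀ x → halve x ≤ 2
halve-≤2 0 = z≤n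
halve-≤2 1 = z≤n
halve-≤2 2 = s≤s z≤n
halve-≤2 3 = ≤-refl
halve-≤2 (suc (suc (suc (suc _)))) = z≤n

halve-scaled : ∀ x → 3 * halve x ≤ 2 * x
halve-scaled 0 = z≤n
halve-scaled 1 = z≤n
halve-scaled 2 = s≤s (s≤s (s≤s z≤n))
halve-scaled 3 = ≤-refl
halve-scaled (suc (suc (suc (suc _)))) = z≤n

-- A vertex with
-- f v = 1 is impossible here: its neighbour of value ≥ 2 violates independence;
-- a vertex with f v = 0 sees a 3 (↦ 2) or two 2s (↦ 1 + 1).
halve-IR2DF : ∀ {n} (G : Graph n) f → IsIDRDF G f → IsIR2DF G (halve ∘ f)
halve-IR2DF {n} G f P = record
  { range    = halve-≤2 ∘ f
  ; zeroCond = zeroCond′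
  ; indep    = independent-map G halve refl indep }
  where
  open IsIDRDF P
  zeroCond′ : ∀ v → halve (f v) ≡ 0 → 2 ≤ nbrSum G (halve ∘ f) v
  zeroCond′ v _ with f v in fv | range v
  ... | 0 | _ with zeroCond v fv
  ...   | inj₁ (w , a , fw) = nbrSum-from-two G (halve ∘ f) v (inj₁ (w , a , cong halve fw))
  ...   | inj₂ (w , w' , w≢w' , a , a' , fw , fw') =
          nbrSum-from-two G (halve ∘ f) v
            (inj₂ (w , w' , w≢w' , a , a' , cong halve fw , cong halve fw'))
  zeroCond′ v _ | 1 | _ with oneCond v fv
  ... | w , a , 2≤fw with indep v w a
  ...   | inj₁ fv≡0 with () ← trans (sym fv) fv≡0
  ...   | inj₂ fw≡0 with () ← subst (2 ≤_) fw≡0 2≤fw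
  zeroCond′ v () | 2 | _
  zeroCond′ v () | 3 | _
  zeroCond′ v _  | suc (suc (suc (suc _))) | s≤s (s≤s (s≤s ()))

lower-bound : ∀ {n} (G : Graph n) {b} → IsIR2 G b → ∀ f → IsIDRDF G f → 3 * b ≤ 2 * weight f
lower-bound G minR2 = min-weight-compare halve 3 2 minR2 (halve-IR2DF G) halve-scaled

promote : ℕ → ℕ
promote 2 = 3
promote 1 = 2
promote _ = 0

promote-≤3 : ∀ x → promote x ≤ 3
promote-≤3 0 = z≤n
promote-≤3 1 = s≤s (s≤s z≤n)
promote-≤3 2 = ≤-refl
promote-≤3 (suc (suc (suc _))) = z≤n

promote-scaled : ∀ x → 1 * promote x ≤ 2 * x
promote-scaled 0 = z≤n
promote-scaled 1 = ≤-refl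
promote-scaled 2 = s≤s (s≤s (s≤s z≤n))
promote-scaled (suc (suc (suc _))) = z≤n

-- promote never produces the value 1, so the 1-condition is vacuous.
promote-≢1 : ∀ x → promote x ≢ 1
promote-≢1 0 ()
promote-≢1 1 ()
promote-≢1 2 ()
promote-≢1 (suc (suc (suc _))) ()

promote-zero : ∀ {x} → x ≤ 2 → promote x ≡ 0 → x ≡ 0
promote-zero z≤n             _ = refl
promote-zero (s≤s z≤n)       ()
promote-zero (s≤s (s≤s z≤n)) ()

-- promote ∘ g is an IDRDF: a vertex of value 0 sees a 2 (↦ 3) or two 1s (↦ 2, 2).
promote-IDRDF : ∀ {n} (G : Graph n) g → IsIR2DF G g → IsIDRDF G (promote ∘ g)
promote-IDRDF {n} G g P = record
  { range    = promote-≤3 ∘ g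
  ; zeroCond = zeroCond′
  ; oneCond  = λ v p1 → ⊥-elim (promote-≢1 (g v) p1)
  ; indep    = independent-map G promote refl indep }
  where
  open IsIR2DF P
  zeroCond′ : ∀ v → promote (g v) ≡ 0 →
    (∃ λ w → adj G v w ≡ true × promote (g w) ≡ 3) ⊎
    (Σ (Fin n) λ w → Σ (Fin n) λ w' → w ≢ w' × adj G v w ≡ true × adj G v w' ≡ true
                                        × promote (g w) ≡ 2 × promote (g w') ≡ 2)
  zeroCond′ v p0 with nbrSum-to-two G g range v (zeroCond v (promote-zero (range v) p0))
  ... | inj₁ (w , a , gw) = inj₁ (w , a , cong promote gw)
  ... | inj₂ (w , w' , w≢w' , a , a' , gw , gw') =
        inj₂ (w , w' , w≢w' , a , a' , cong promote gw , cong promote gw')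

upper-bound : ∀ {n} (G : Graph n) {a} → IsIdR G a → ∀ g → IsIR2DF G g → a ≤ 2 * weight g
upper-bound G {a} minDR g Pg =
  subst (_≤ 2 * weight g) (*-identityˡ a)
        (min-weight-compare promote 1 2 minDR (promote-IDRDF G) promote-scaled g Pg)

idR-from-lower-bound : ∀ {n} (G : Graph n) {a b} → IsIR2 G b →
                       (∃ λ f → IsIDRDF G f × weight f ≡ a) →
                       (∀ w → 3 * b ≤ 2 * w → a ≤ w) → IsIdR G a
idR-from-lower-bound G minR2 witness forced =
  witness , λ f Pf → forced (weight f) (lower-bound G minR2 f Pf)

K₁ : Graph 1
K₁ = record { adj = λ _ _ → false ; sym = λ _ _ → refl ; irrefl = λ _ → refl }

-- An isolated vertex cannot have value 0, so i_{R2}(K₁) = 1.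
K₁-R2 : IsIR2 K₁ 1
K₁-R2 = ((λ _ → 1) , record { range = λ _ → s≤s z≤n ; zeroCond = λ _ () ; indep = λ _ _ () } , refl)
      , minimal
  where
  minimal : ∀ g → IsIR2DF K₁ g → 1 ≤ weight g
  minimal g P with g zero in g0
  ... | 0     with () ← IsIR2DF.zeroCond P zero g0
  ... | suc _ = s≤s z≤n

-- i_dR(K₁) = 2: the constant 2 is an IDRDF and 3 · 1 ≤ 2 · w forces w ≥ 2.
K₁-dR : IsIdR K₁ 2
K₁-dR = idR-from-lower-bound K₁ K₁-R2 ((λ _ → 2) , two-IDRDF , refl) forced
  where
  two-IDRDF : IsIDRDF K₁ (λ _ → 2)
  two-IDRDF = record { range = λ _ → s≤s (s≤s z≤n) ; zeroCond = λ _ ()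
                     ; oneCond = λ _ () ; indep = λ _ _ () }
  forced : ∀ w → 3 ≤ 2 * w → 2 ≤ w
  forced (suc (suc _)) _ = s≤s (s≤s z≤n)
  forced 0 ()
  forced 1 (s≤s (s≤s ()))

K₂-adj : Fin 2 → Fin 2 → Bool
K₂-adj zero       zero       = false
K₂-adj zero       (suc zero) = true
K₂-adj (suc zero) zero       = true
K₂-adj (suc zero) (suc zero) = false

K₂ : Graph 2
K₂ = record { adj = K₂-adj ; sym = symmetric ; irrefl = irreflexive }
  where
  symmetric : ∀ u v → K₂-adj u v ≡ K₂-adj v u
  symmetric zero       zero       = refl
  symmetric zero       (suc zero) = refl
  symmetric (suc zero) zero       = refl
  symmetric (suc zero) (suc zero) = refl
  irreflexive : ∀ v → K₂-adj v v ≡ false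
  irreflexive zero       = refl
  irreflexive (suc zero) = refl

onFirst : ℕ → Fin 2 → ℕ
onFirst c zero       = c
onFirst c (suc zero) = 0

onFirst-independent : ∀ c → Independent K₂ (onFirst c)
onFirst-independent c zero       zero       ()
onFirst-independent c zero       (suc zero) _ = inj₂ refl
onFirst-independent c (suc zero) zero       _ = inj₁ refl
onFirst-independent c (suc zero) (suc zero) ()

-- i_{R2}(K₂) = 2: by independence some endpoint is 0, so the other carries ≥ 2.
K₂-R2 : IsIR2 K₂ 2
K₂-R2 = (onFirst 2 , record { range = range ; zeroCond = zeroCond ; indep = onFirst-independent 2 } , refl)
      , minimal
  where
  range : ∀ v → onFirst 2 v ≤ 2
  range zero       = ≤-refl
  range (suc zero) = z≤n
  zeroCond : ∀ v → onFirst 2 v ≡ 0 → 2 ≤ nbrSum K₂ (onFirst 2) v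
  zeroCond (suc zero) _ = ≤-refl
  minimal : ∀ g → IsIR2DF K₂ g → 2 ≤ weight g
  minimal g P with IsIR2DF.indep P zero (suc zero) refl
  ... | inj₁ g0 = subst (λ x → 2 ≤ x + (g (suc zero) + 0)) (sym g0) (IsIR2DF.zeroCond P zero g0)
  ... | inj₂ g1 = subst (λ x → 2 ≤ g zero + (x + 0)) (sym g1) (IsIR2DF.zeroCond P (suc zero) g1)

-- i_dR(K₂) = 3: (3, 0) is an IDRDF and 3 · 2 ≤ 2 · w forces w ≥ 3.
K₂-dR : IsIdR K₂ 3
K₂-dR = idR-from-lower-bound K₂ K₂-R2 (onFirst 3 , three-IDRDF , refl) (λ w → *-cancelˡ-≤ 2)
  where
  three-IDRDF : IsIDRDF K₂ (onFirst 3)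
  three-IDRDF = record { range = range ; zeroCond = zeroCond ; oneCond = oneCond
                       ; indep = onFirst-independent 3 }
    where
    range : ∀ v → onFirst 3 v ≤ 3
    range zero       = ≤-refl
    range (suc zero) = z≤n
    zeroCond : ∀ v → onFirst 3 v ≡ 0 →
      (∃ λ w → K₂-adj v w ≡ true × onFirst 3 w ≡ 3) ⊎
      (Σ (Fin 2) λ w → Σ (Fin 2) λ w' → w ≢ w' × K₂-adj v w ≡ true × K₂-adj v w' ≡ true
                                          × onFirst 3 w ≡ 2 × onFirst 3 w' ≡ 2)
    zeroCond (suc zero) _ = inj₁ (zero , refl , refl)
    oneCond : ∀ v → onFirst 3 v ≡ 1 → ∃ λ w → K₂-adj v w ≡ true × 2 ≤ onFirst 3 w
    oneCond zero       ()
    oneCond (suc zero) ()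

proposition5 : ((n : ℕ) (G : Graph n) (a b : ℕ) → IsIdR G a → IsIR2 G b → (3 * b ≤ 2 * a) × (a ≤ 2 * b))
    × (Σ ℕ λ n → 1 ≤ n × Σ (Graph n) λ G → Σ ℕ λ a → Σ ℕ λ b → IsIdR G a × IsIR2 G b × 3 * b ≡ 2 * a)
    × (Σ ℕ λ n → 1 ≤ n × Σ (Graph n) λ G → Σ ℕ λ a → Σ ℕ λ b → IsIdR G a × IsIR2 G b × a ≡ 2 * b)
proposition5 = bounds
             , (2 , s≤s z≤n , K₂ , 3 , 2 , K₂-dR , K₂-R2 , refl)
             , (1 , s≤s z≤n , K₁ , 2 , 1 , K₁-dR , K₁-R2 , refl)
  where
  bounds : (n : ℕ) (G : Graph n) (a b : ℕ) → IsIdR G a → IsIR2 G b → (3 * b ≤ 2 * a) × (a ≤ 2 * b)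
  bounds n G a b minDR@((f , Pf , wf) , _) minR2@((g , Pg , wg) , _) =
      subst (λ w → 3 * b ≤ 2 * w) wf (lower-bound G minR2 f Pf)
    , subst (λ w → a ≤ 2 * w) wg (upper-bound G minDR g Pg)
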